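{- Let $f\colon m\to n$ be a function between finite ordinals, and let $R=J(f^{op})\colon n\to m$ be the corresponding arrow of $\mathit{Gen}$, i.e. the equivalence relation on $n+m=\{0,\dots,n+m-1\}$ whose equivalence classes are exactly the $n$ sets $\{i\}\cup\{j+n\mid j\in m,\ f(j)=i\}$ for $i\in n$. Let $\overrightarrow{ab}=a_0\ldots a_{n-1}b_0\ldots b_{m-1}$ be a sequence of finite ordinals, each $\ge 2$, which is appropriate for $R$. Then the relation $F_{\overrightarrow{ab}}(R)\subseteq (a_0\cdots a_{n-1})\times(b_0\cdots b_{m-1})$ is (the graph of) a function from $a_0\cdots a_{n-1}$ to $b_0\cdots b_{m-1}$.
   Context: $\mathit{Gen}$ is the category whose objects are finite ordinals and whose arrows $n\to m$ are arbitrary equivalence relations on the ordinal $n+m$ (elements $i<n$ represent the source, elements $n+j$ with $j<m$ represent the target). For a finite sequence $\overrightarrow{d}=d_0\ldots d_{k-1}$ of finite ordinals, let $\iota_{\overrightarrow{d}}\colon d_0\times\dots\times d_{k-1}\to d_0\cdots d_{k-1}$ be the bijection $\iota_{\overrightarrow{d}}(i_0,\dots,i_{k-1})=\sum_{l=0}^{k-1} i_l\cdot d_{l+1}\cdots d_{k-1}$ (the position of the tuple in the lexicographic order; an empty product equals $1$). For an arrow $R\colon n\to m$ of $\mathit{Gen}$ and a sequence $\overrightarrow{ab}=a_0\ldots a_{n-1}b_0\ldots b_{m-1}$ of finite ordinals $\ge 2$, define $F_{\overrightarrow{ab}}(R)$ as the set of pairs $(i,j)\in(a_0\cdots a_{n-1})\times(b_0\cdots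 b_{m-1})$ such that, letting $\overrightarrow{c}=(c_0,\dots,c_{n+m-1})$ be the concatenation of the $n$-tuple $\iota_{\overrightarrow{a}}^{ -1}(i)$ and the $m$-tuple $\iota_{\overrightarrow{b}}^{ -1}(j)$, we have $c_x=c_y$ for all $x,y\in n+m$ with $(x,y)\in R$. Writing $e_x=a_x$ for $x<n$ and $e_{n+j}=b_j$ for $j<m$, the sequence $\overrightarrow{ab}$ is appropriate for $R$ when $(x,y)\in R$ implies $e_x=e_y$. -}

module Defs where

open import Data.Nat using (ℕ; zero; suc; _*_; _+_; _≤_)
open import Data.Fin using (Fin; zero; suc; toℕ; splitAt; remQuot)
open import Data.Sum using ([_,_])
open import Data.Product using (proj₁; proj₂)
open import Data.Vec.Functional using (_++_)
open import Relation.Binary.PropositionalEquality using (_≡_)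

prod : (k : ℕ) → (Fin k → ℕ) → ℕ
prod zero    d = 1
prod (suc k) d = d zero * prod k (λ l → d (suc l))

-- ι_d⁻¹ : d_0 ⋯ d_{k-1} → d_0 × ⋯ × d_{k-1}, the inverse of the lexicographic
-- bijection ι_d(i_0,…,i_{k-1}) = Σ_l i_l · d_{l+1}⋯d_{k-1}.
-- remQuot n (q·n + r) = (q , r), so this peels off the most significant digit.
-- Components are returned as natural numbers (the l-th one is < d_l).
ιinv : (k : ℕ) (d : Fin k → ℕ) → Fin (prod k d) → Fin k → ℕ
ιinv zero    d i ()
ιinv (suc k) d i zero    = toℕ (proj₁ (remQuot {d zero} (prod k (λ l → d (suc l))) i))
ιinv (suc k) d i (suc l) =
  ιinv k (λ l → d (suc l)) (proj₂ (remQuot {d zero} (prod k (λ l → d (suc l))) i)) l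

-- The arrow R = J(f^op) : n → m of Gen for f : m → n, as a relation on n+m:
-- x ∈ n+m lies in the class indexed by cls f x ∈ n, where an element i < n
-- lies in class i and an element n + j (j < m) lies in class f j.
cls : (n m : ℕ) → (Fin m → Fin n) → Fin (n + m) → Fin n
cls n m f x = [ (λ i → i) , f ] (splitAt n x)

Jop : (n m : ℕ) → (Fin m → Fin n) → Fin (n + m) → Fin (n + m) → Set
Jop n m f x y = cls n m f x ≡ cls n m f y

seqAB : (n m : ℕ) → (Fin n → ℕ) → (Fin m → ℕ) → Fin (n + m) → ℕ
seqAB n m a b = a ++ b

Appropriate : (n m : ℕ) → (Fin (n + m) → Fin (n + m) → Set) →
              (Fin n → ℕ) → (Fin m → ℕ) → Set
Appropriate n m R a b = ∀ x y → R x y → seqAB n m a b x ≡ seqAB n m a b y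

F : (n m : ℕ) → (Fin (n + m) → Fin (n + m) → Set) →
    (a : Fin n → ℕ) → (b : Fin m → ℕ) → Fin (prod n a) → Fin (prod m b) → Set
F n m R a b i j =
  ∀ x y → R x y → (ιinv n a i ++ ιinv m b j) x ≡ (ιinv n a i ++ ιinv m b j) y

module Submission where

-- By the definition of F, a pair (i , j) lies in F_ab(J(f^op))
-- exactly when the digit tuple of i followed by that of j is constant on
-- every class {i'} ∪ f⁻¹(i') of J(f^op), i.e. when the l-th digit of j equals
-- the f(l)-th digit of i for every l < m.  So the unique candidate for the
-- image of i is the number whose digits are (ιinv a i) ∘ f; it exists because
-- appropriateness gives a (f l) = b l, so these digits are admissible in
-- radix b, and it is unique because a number is determined by its digits.

open import Defs
open import Data.Nat using (ℕ; _≤_; _<_; zero; suc)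
open import Data.Fin using (Fin; zero; suc; toℕ; fromℕ<; combine; remQuot; splitAt; _↑ˡ_; _↑ʳ_)
open import Data.Fin.Properties using (toℕ-injective; toℕ<n; toℕ-fromℕ<; remQuot-combine; combine-remQuot; splitAt-↑ˡ; splitAt-↑ʳ)
open import Data.Product using (∃!; _,_; proj₁; proj₂; uncurry)
open import Data.Sum using (inj₁; inj₂)
open import Data.Vec.Functional using (_++_; tail)
open import Data.Vec.Functional.Properties using (lookup-++ˡ; lookup-++ʳ)
open import Function using (_∘_)
open import Relation.Binary.PropositionalEquality using (_≡_; refl; sym; trans; cong; cong₂; subst; module ≡-Reasoning)

ιinv-bounded : (k : ℕ) (d : Fin k → ℕ) (i : Fin (prod k d)) (l : Fin k) →
               ιinv k d i l < d l
ιinv-bounded (suc k) d i zero    = toℕ<n _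
ιinv-bounded (suc k) d i (suc l) = ιinv-bounded k (tail d) _ l

ι : (k : ℕ) (d : Fin k → ℕ) (c : Fin k → ℕ) → (∀ l → c l < d l) → Fin (prod k d)
ι zero    d c c<d = zero
ι (suc k) d c c<d = combine (fromℕ< (c<d zero)) (ι k (tail d) (tail c) (λ l → c<d (suc l)))

ιinv-combine-head : (k : ℕ) (d : Fin (suc k) → ℕ) (q : Fin (d zero)) (r : Fin (prod k (tail d))) →
                    ιinv (suc k) d (combine q r) zero ≡ toℕ q
ιinv-combine-head k d q r = cong (toℕ ∘ proj₁) (remQuot-combine {d zero} {prod k (tail d)} q r)

ιinv-combine-tail : (k : ℕ) (d : Fin (suc k) → ℕ) (q : Fin (d zero)) (r : Fin (prod k (tail d))) (l : Fin k) →
                    ιinv (suc k) d (combine q r) (suc l) ≡ ιinv k (tail d) r l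
ιinv-combine-tail k d q r l =
  cong (λ qr → ιinv k (tail d) (proj₂ qr) l) (remQuot-combine {d zero} {prod k (tail d)} q r)

ιinv-ι : (k : ℕ) (d : Fin k → ℕ) (c : Fin k → ℕ) (c<d : ∀ l → c l < d l) (l : Fin k) →
         ιinv k d (ι k d c c<d) l ≡ c l
ιinv-ι (suc k) d c c<d zero =
  trans (ιinv-combine-head k d _ _) (toℕ-fromℕ< (c<d zero))
ιinv-ι (suc k) d c c<d (suc l) =
  trans (ιinv-combine-tail k d _ _ l) (ιinv-ι k (tail d) (tail c) (λ l → c<d (suc l)) l)

ιinv-injective : (k : ℕ) (d : Fin k → ℕ) (i i′ : Fin (prod k d)) →
                 (∀ l → ιinv k d i l ≡ ιinv k d i′ l) → i ≡ i′
ιinv-injective zero    d zero zero same = refl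
ιinv-injective (suc k) d i i′ same = begin
    i                                        ≡⟨ sym (combine-remQuot {d zero} K i) ⟩
    uncurry combine (remQuot {d zero} K i)   ≡⟨ cong₂ combine sameHead sameTail ⟩
    uncurry combine (remQuot {d zero} K i′)  ≡⟨ combine-remQuot {d zero} K i′ ⟩
    i′                                       ∎
  where
  open ≡-Reasoning
  K : ℕ
  K = prod k (tail d)
  sameHead : proj₁ (remQuot {d zero} K i) ≡ proj₁ (remQuot {d zero} K i′)
  sameHead = toℕ-injective (same zero)
  sameTail : proj₂ (remQuot {d zero} K i) ≡ proj₂ (remQuot {d zero} K i′)
  sameTail = ιinv-injective k (tail d) _ _ (same ∘ suc)

Jop-relates : (n m : ℕ) (f : Fin m → Fin n) (j : Fin m) →
              Jop n m f (f j ↑ˡ m) (n ↑ʳ j)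
Jop-relates n m f j rewrite splitAt-↑ˡ n (f j) m | splitAt-↑ʳ n m j = refl

++-through-cls : (n m : ℕ) (f : Fin m → Fin n) {A : Set} (c : Fin n → A) (e : Fin m → A) →
                 (∀ j → e j ≡ c (f j)) → ∀ x → (c ++ e) x ≡ c (cls n m f x)
++-through-cls n m f c e e≡c∘f x with splitAt n x
... | inj₁ i = refl
... | inj₂ j = e≡c∘f j

respects-Jop : (n m : ℕ) (f : Fin m → Fin n) {A : Set} (c : Fin n → A) (e : Fin m → A) →
               (∀ x y → Jop n m f x y → (c ++ e) x ≡ (c ++ e) y) →
               ∀ j → e j ≡ c (f j)
respects-Jop n m f c e respects j = begin
    e j                        ≡⟨ sym (lookup-++ʳ c e j) ⟩
    (c ++ e) (n ↑ʳ j)          ≡⟨ sym (respects _ _ (Jop-relates n m f j)) ⟩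
    (c ++ e) (f j ↑ˡ m)        ≡⟨ lookup-++ˡ c e (f j) ⟩
    c (f j)                    ∎
  where open ≡-Reasoning

appropriate-radices : (n m : ℕ) (f : Fin m → Fin n) (a : Fin n → ℕ) (b : Fin m → ℕ) →
                      Appropriate n m (Jop n m f) a b → ∀ j → b j ≡ a (f j)
appropriate-radices n m f a b = respects-Jop n m f a b

-- A pair whose digits satisfy the equation lies in F: the concatenated tuple
-- is then a function of the class of a point.
F-sound : (n m : ℕ) (f : Fin m → Fin n) (a : Fin n → ℕ) (b : Fin m → ℕ)
          (i : Fin (prod n a)) (j : Fin (prod m b)) →
          (∀ l → ιinv m b j l ≡ ιinv n a i (f l)) → F n m (Jop n m f) a b i j
F-sound n m f a b i j digits x y x~y = begin
    (c ++ e) x           ≡⟨ ++-through-cls n m f c e digits x ⟩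
    c (cls n m f x)      ≡⟨ cong c x~y ⟩
    c (cls n m f y)      ≡⟨ sym (++-through-cls n m f c e digits y) ⟩
    (c ++ e) y           ∎
  where
  open ≡-Reasoning
  c : Fin n → ℕ
  c = ιinv n a i
  e : Fin m → ℕ
  e = ιinv m b j

F-complete : (n m : ℕ) (f : Fin m → Fin n) (a : Fin n → ℕ) (b : Fin m → ℕ)
             (i : Fin (prod n a)) (j : Fin (prod m b)) →
             F n m (Jop n m f) a b i j → ∀ l → ιinv m b j l ≡ ιinv n a i (f l)
F-complete n m f a b i j = respects-Jop n m f (ιinv n a i) (ιinv m b j)

lemma2 : (n m : ℕ) (f : Fin m → Fin n) (a : Fin n → ℕ) (b : Fin m → ℕ) →
    (∀ i → 2 ≤ a i) → (∀ j → 2 ≤ b j) →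
    Appropriate n m (Jop n m f) a b →
    (i : Fin (prod n a)) → ∃! _≡_ (λ j → F n m (Jop n m f) a b i j)
lemma2 n m f a b _ _ appropriate i = image , F-sound n m f a b i image digits , unique
  where
  -- the digits (ιinv a i) ∘ f are admissible in radix b because b = a ∘ f
  c<b : ∀ l → ιinv n a i (f l) < b l
  c<b l = subst (ιinv n a i (f l) <_) (sym (appropriate-radices n m f a b appropriate l))
                (ιinv-bounded n a i (f l))
  image : Fin (prod m b)
  image = ι m b (ιinv n a i ∘ f) c<b
  digits : ∀ l → ιinv m b image l ≡ ιinv n a i (f l)
  digits = ιinv-ι m b (ιinv n a i ∘ f) c<b
  unique : ∀ {j} → F n m (Jop n m f) a b i j → image ≡ j
  unique {j} inF = ιinv-injective m b image j λ l →
    trans (digits l) (sym (F-complete n m f a b i j inF l))
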